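{- For every $\phi\in\mathcal L$ and all nonnegative rationals $\varepsilon,\varepsilon'$: 1. $\vdash_{\varepsilon+\varepsilon'}\phi$ iff $\vdash_\varepsilon\langle\phi\rangle_{\varepsilon'}$; in particular $\vdash_\varepsilon\phi$ iff $\vdash\langle\phi\rangle_\varepsilon$. 2. $\vdash_\varepsilon\phi$ iff $\vdash_{\varepsilon+\varepsilon'}\langle\phi\rangle^{\varepsilon'}$; in particular $\vdash\phi$ iff $\vdash_\varepsilon\langle\phi\rangle^\varepsilon$. 3. If $\phi\in\mathcal L^+$, then $\vdash_{\varepsilon'}\phi$ implies $\vdash_{\varepsilon+\varepsilon'}\phi$.
   Context: Formulae $\mathcal L$: $\phi::=\top\mid\neg\phi\mid\phi\land\phi\mid L_r\phi$, $r$ a nonnegative rational; other Boolean connectives are abbreviations, $\bot=\neg\top$. $\mathcal L^+$ is the sublanguage generated by $\psi::=\top\mid\psi\land\psi\mid\psi\lor\psi\mid L_r\psi$. Encodings: $\langle\cdot\rangle_\varepsilon,\langle\cdot\rangle^\varepsilon:\mathcal L\to\mathcal L$ commute with $\top$, $\neg$, $\land$, and $\langle L_r\phi\rangle_\varepsilon=L_{r\dot-\varepsilon}\langle\phi\rangle_\varepsilon$, $\langle L_r\phi\rangle^\varepsilon=L_{r+\varepsilon}\langle\phi\rangle^\varepsilon$, with $r\dot-\varepsilon=\max\{0,r-\varepsilon\}$. $\varepsilon$-provability ($\varepsilon\ge 0$ rational): $\vdash_\varepsilon$ is the proof system consisting of classical propositional logic together with, for all $\phi,\psi\in\mathcal L$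 and nonnegative rationals $r,s$: (A1) $L_\varepsilon\phi$; (A2) $L_{r+s}\phi\to L_r\phi$; (A3) $L_r(\phi\land\psi)\land L_s(\phi\land\neg\psi)\to L_{r+s-\varepsilon}\phi$; (A4) $\neg L_r(\phi\land\psi)\land\neg L_s(\phi\land\neg\psi)\to\neg L_{r+s-\varepsilon}\phi$; (R1) from $\vdash_\varepsilon\phi\to\psi$ infer $\vdash_\varepsilon L_r\phi\to L_r\psi$; (R2) from all of $\{L_r\phi\mid r<s\}$ infer $L_s\phi$; (R3) from all of $\{L_r\phi\mid r>s\}$ infer $\bot$. $\vdash_\varepsilon\phi$ means $\phi$ is derivable; $\vdash$ denotes $\vdash_0$. -}

module Defs where

open import Data.Bool using (Bool; true; false; not; _∧_)
open import Data.Product using (_×_; _,_)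
open import Relation.Binary.PropositionalEquality using (_≡_)
open import Data.Rational using (ℚ; 0ℚ; _≤_; _<_; _⊔_)
  renaming (_+_ to _+ℚ_; _-_ to _-ℚ_)
open import Data.Rational.Properties using (+-mono-≤; p≤p⊔q)
open import Data.Rational.Properties using (+-identityˡ)
open import Relation.Binary.PropositionalEquality using (subst)

record ℚ⁺ : Set where
  constructor ⟨_,_⟩
  field
    val    : ℚ
    nonneg : 0ℚ ≤ val
open ℚ⁺ public

0⁺ : ℚ⁺
0⁺ = ⟨ 0ℚ , Data.Rational.Properties.≤-refl ⟩

infixl 6 _+⁺_ _∸⁺_
_+⁺_ : ℚ⁺ → ℚ⁺ → ℚ⁺
⟨ r , p ⟩ +⁺ ⟨ s , q ⟩ =
  ⟨ r +ℚ s , subst (_≤ (r +ℚ s)) (+-identityˡ 0ℚ) (+-mono-≤ p q) ⟩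

_∸⁺_ : ℚ⁺ → ℚ⁺ → ℚ⁺
r ∸⁺ e = ⟨ 0ℚ ⊔ (val r -ℚ val e) , p≤p⊔q 0ℚ (val r -ℚ val e) ⟩

_<⁺_ : ℚ⁺ → ℚ⁺ → Set
r <⁺ s = val r < val s

-- "x + y - z" as a nonnegative rational: the axiom instances A3/A4 exist
-- only when val z ≤ val x + val y (so that the index is a nonneg. rational)
-- Formulae

infixr 6 _∧ᶠ_
data Form : Set where
  ⊤ᶠ   : Form
  ¬ᶠ_  : Form → Form
  _∧ᶠ_ : Form → Form → Form
  L    : ℚ⁺ → Form → Form

⊥ᶠ : Form
⊥ᶠ = ¬ᶠ ⊤ᶠ

infixr 5 _∨ᶠ_
_∨ᶠ_ : Form → Form → Form
φ ∨ᶠ ψ = ¬ᶠ ((¬ᶠ φ) ∧ᶠ (¬ᶠ ψ))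

infixr 4 _⇒_
_⇒_ : Form → Form → Form
φ ⇒ ψ = ¬ᶠ (φ ∧ᶠ (¬ᶠ ψ))

infix 3 _⇔ᶠ_
_⇔ᶠ_ : Form → Form → Form
φ ⇔ᶠ ψ = (φ ⇒ ψ) ∧ᶠ (ψ ⇒ φ)

data Pos : Form → Set where
  pos⊤ : Pos ⊤ᶠ
  pos∧ : ∀ {φ ψ} → Pos φ → Pos ψ → Pos (φ ∧ᶠ ψ)
  pos∨ : ∀ {φ ψ} → Pos φ → Pos ψ → Pos (φ ∨ᶠ ψ)
  posL : ∀ {r φ} → Pos φ → Pos (L r φ)

⟨_⟩₋ : Form → ℚ⁺ → Form
⟨ ⊤ᶠ ⟩₋ e = ⊤ᶠ
⟨ ¬ᶠ φ ⟩₋ e = ¬ᶠ (⟨ φ ⟩₋ e)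
⟨ φ ∧ᶠ ψ ⟩₋ e = ⟨ φ ⟩₋ e ∧ᶠ ⟨ ψ ⟩₋ e
⟨ L r φ ⟩₋ e = L (r ∸⁺ e) (⟨ φ ⟩₋ e)

⟨_⟩⁺ : Form → ℚ⁺ → Form
⟨ ⊤ᶠ ⟩⁺ e = ⊤ᶠ
⟨ ¬ᶠ φ ⟩⁺ e = ¬ᶠ (⟨ φ ⟩⁺ e)
⟨ φ ∧ᶠ ψ ⟩⁺ e = ⟨ φ ⟩⁺ e ∧ᶠ ⟨ ψ ⟩⁺ e
⟨ L r φ ⟩⁺ e = L (r +⁺ e) (⟨ φ ⟩⁺ e)

eval : (ℚ⁺ → Form → Bool) → Form → Bool
eval v ⊤ᶠ = true
eval v (¬ᶠ φ) = not (eval v φ)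
eval v (φ ∧ᶠ ψ) = eval v φ ∧ eval v ψ
eval v (L r φ) = v r φ

Tautology : Form → Set
Tautology φ = ∀ (v : ℚ⁺ → Form → Bool) → eval v φ ≡ true

infix 2 _⊢_
data _⊢_ (ε : ℚ⁺) : Form → Set where
  taut : ∀ {φ} → Tautology φ → ε ⊢ φ
  mp   : ∀ {φ ψ} → ε ⊢ φ ⇒ ψ → ε ⊢ φ → ε ⊢ ψ
  A1   : ∀ {φ} → ε ⊢ L ε φ
  A2   : ∀ {φ} r s → ε ⊢ L (r +⁺ s) φ ⇒ L r φ
  A3   : ∀ {φ ψ} r s t → val t ≡ (val r +ℚ val s) -ℚ val ε →
         ε ⊢ (L r (φ ∧ᶠ ψ) ∧ᶠ L s (φ ∧ᶠ ¬ᶠ ψ)) ⇒ L t φ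
  A4   : ∀ {φ ψ} r s t → val t ≡ (val r +ℚ val s) -ℚ val ε →
         ε ⊢ (¬ᶠ L r (φ ∧ᶠ ψ) ∧ᶠ ¬ᶠ L s (φ ∧ᶠ ¬ᶠ ψ)) ⇒ ¬ᶠ L t φ
  R1   : ∀ {φ ψ} r → ε ⊢ φ ⇒ ψ → ε ⊢ L r φ ⇒ L r ψ
  R2   : ∀ {φ} s → (∀ r → r <⁺ s → ε ⊢ L r φ) → ε ⊢ L s φ
  R3   : ∀ {φ} s → (∀ r → s <⁺ r → ε ⊢ L r φ) → ε ⊢ ⊥ᶠ

infix 2 ⊢₀_
⊢₀_ : Form → Set
⊢₀ φ = 0⁺ ⊢ φ

-- Lowering every index by ε′ (truncated at 0) turns each axiom and rule of the
-- (ε + ε′)-calculus into an instance of the same axiom or rule of the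
-- ε-calculus, and raising every index by ε′ turns the ε-calculus into the
-- (ε + ε′)-calculus.  Instances of A3 and A4 whose index r + s − ε would be
-- negative do not exist, but they are not needed: a formula L r φ with r ≤ ε
-- is provable from A1 and A2.  For the converses, ⟨ ⟨ φ ⟩⁺ ε′ ⟩₋ ε′ is φ
-- itself, while ⟨ ⟨ φ ⟩₋ ε′ ⟩⁺ ε′ differs from φ only by raising indices below
-- ε′ to ε′, which a calculus with ε ≥ ε′ cannot tell apart.  On positive
-- formulas raising indices strengthens the formula, so monotonicity in ε
-- follows from the raising translation.
module Submission where

open import Data.Bool using (Bool; true; false; not; _∧_)
open import Data.Bool.Properties using (∧-conicalˡ; ∧-conicalʳ)
open import Data.Empty using (⊥; ⊥-elim)
open import Data.Product using (_×_; _,_; proj₁)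
open import Data.Rational using (0ℚ; _≤_; _<_; -_) renaming (_+_ to _+ℚ_; _-_ to _-ℚ_)
open import Data.Rational.Properties
open import Data.Rational.Solver using (module +-*-Solver)
open import Data.Sum using (inj₁; inj₂)
open import Function.Bundles using (_⇔_; mk⇔)
open import Relation.Binary.PropositionalEquality
open import Defs

open +-*-Solver

infixr 4 _⟹_
_⟹_ : Bool → Bool → Bool
x ⟹ y = not (x ∧ not y)

-- The first Boolean is explicit: unification cannot recover it through not and _∧_.
⟹-intro : ∀ x {y} → (x ≡ true → y ≡ true) → (x ⟹ y) ≡ true
⟹-intro false _ = refl
⟹-intro true {true} _ = refl
⟹-intro true {false} f = f refl

⟹-elim : ∀ x {y} → (x ⟹ y) ≡ true → x ≡ true → y ≡ true
⟹-elim true {true} _ _ = refl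
⟹-elim true {false} () _
⟹-elim false _ ()

not-intro : ∀ x → (x ≡ true → ⊥) → not x ≡ true
not-intro true f = ⊥-elim (f refl)
not-intro false _ = refl

not-elim : ∀ x → not x ≡ true → x ≡ true → ⊥
not-elim true ()
not-elim false _ ()

∧-intro : ∀ {x y} → x ≡ true → y ≡ true → x ∧ y ≡ true
∧-intro refl refl = refl

module _ {ε : ℚ⁺} where

  infer : ∀ {φ ψ} → (∀ v → eval v φ ≡ true → eval v ψ ≡ true) → ε ⊢ φ → ε ⊢ ψ
  infer {φ} h = mp (taut λ v → ⟹-intro (eval v φ) (h v))

  infer₂ : ∀ {φ ψ χ} → (∀ v → eval v φ ≡ true → eval v ψ ≡ true → eval v χ ≡ true) →
           ε ⊢ φ → ε ⊢ ψ → ε ⊢ χ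
  infer₂ {φ} {ψ} h ⊢φ ⊢ψ =
    mp (mp (taut λ v → ⟹-intro (eval v φ) λ hφ → ⟹-intro (eval v ψ) (h v hφ)) ⊢φ) ⊢ψ

  ⇒-refl : ∀ {φ} → ε ⊢ φ ⇒ φ
  ⇒-refl {φ} = taut λ v → ⟹-intro (eval v φ) λ h → h

  ⇒-const : ∀ {φ ψ} → ε ⊢ ψ → ε ⊢ φ ⇒ ψ
  ⇒-const {φ} = infer λ v hψ → ⟹-intro (eval v φ) λ _ → hψ

  ⇒-trans : ∀ {φ ψ χ} → ε ⊢ φ ⇒ ψ → ε ⊢ ψ ⇒ χ → ε ⊢ φ ⇒ χ
  ⇒-trans {φ} {ψ} = infer₂ λ v hφψ hψχ → ⟹-intro (eval v φ) λ hφ →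
    ⟹-elim (eval v ψ) hψχ (⟹-elim (eval v φ) hφψ hφ)

  ⇒-contrapose : ∀ {φ ψ} → ε ⊢ φ ⇒ ψ → ε ⊢ ¬ᶠ ψ ⇒ ¬ᶠ φ
  ⇒-contrapose {φ} {ψ} = infer λ v hφψ → ⟹-intro (not (eval v ψ)) λ h¬ψ →
    not-intro (eval v φ) λ hφ → not-elim (eval v ψ) h¬ψ (⟹-elim (eval v φ) hφψ hφ)

  ∧-mono : ∀ {φ φ′ ψ ψ′} → ε ⊢ φ ⇒ φ′ → ε ⊢ ψ ⇒ ψ′ → ε ⊢ φ ∧ᶠ ψ ⇒ φ′ ∧ᶠ ψ′
  ∧-mono {φ} {_} {ψ} = infer₂ λ v hφ hψ → ⟹-intro (eval v φ ∧ eval v ψ) λ h →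
    ∧-intro (⟹-elim (eval v φ) hφ (∧-conicalˡ _ _ h)) (⟹-elim (eval v ψ) hψ (∧-conicalʳ _ _ h))

  ∨-mono : ∀ {φ φ′ ψ ψ′} → ε ⊢ φ ⇒ φ′ → ε ⊢ ψ ⇒ ψ′ → ε ⊢ φ ∨ᶠ ψ ⇒ φ′ ∨ᶠ ψ′
  ∨-mono ⊢φ ⊢ψ = ⇒-contrapose (∧-mono (⇒-contrapose ⊢φ) (⇒-contrapose ⊢ψ))

  refuteˡ : ∀ {φ ψ χ} → ε ⊢ φ → ε ⊢ ¬ᶠ φ ∧ᶠ ψ ⇒ χ
  refuteˡ {φ} {ψ} = infer λ v hφ → ⟹-intro (not (eval v φ) ∧ eval v ψ) λ h →
    ⊥-elim (not-elim (eval v φ) (∧-conicalˡ _ _ h) hφ)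

  refuteʳ : ∀ {φ ψ χ} → ε ⊢ φ → ε ⊢ ψ ∧ᶠ ¬ᶠ φ ⇒ χ
  refuteʳ {φ} {ψ} = infer λ v hφ → ⟹-intro (eval v ψ ∧ not (eval v φ)) λ h →
    ⊥-elim (not-elim (eval v φ) (∧-conicalʳ _ _ h) hφ)

infix 4 _≤⁺_
_≤⁺_ : ℚ⁺ → ℚ⁺ → Set
r ≤⁺ s = val r ≤ val s

val-injective : ∀ {r s} → val r ≡ val s → r ≡ s
val-injective {⟨ _ , p ⟩} {⟨ _ , q ⟩} refl = cong (⟨_,_⟩ _) (≤-irrelevant p q)

p+q-q≡p : ∀ p q → (p +ℚ q) -ℚ q ≡ p
p+q-q≡p = solve 2 (λ p q → (p :+ q) :- q := p) refl

p-q+q≡p : ∀ p q → (p -ℚ q) +ℚ q ≡ p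
p-q+q≡p = solve 2 (λ p q → (p :- q) :+ q := p) refl

p≤q⇒p-q≤0 : ∀ {p q} → p ≤ q → p -ℚ q ≤ 0ℚ
p≤q⇒p-q≤0 {p} {q} p≤q = subst (p -ℚ q ≤_) (+-inverseʳ q) (+-monoˡ-≤ (- q) p≤q)

p≤q⇒0≤q-p : ∀ {p q} → p ≤ q → 0ℚ ≤ q -ℚ p
p≤q⇒0≤q-p {p} {q} p≤q = subst (_≤ q -ℚ p) (+-inverseʳ p) (+-monoˡ-≤ (- p) p≤q)

+⁺-identityˡ : ∀ r → 0⁺ +⁺ r ≡ r
+⁺-identityˡ r = val-injective (+-identityˡ (val r))

+⁺-comm : ∀ r s → r +⁺ s ≡ s +⁺ r
+⁺-comm r s = val-injective (+-comm (val r) (val s))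

r≤r+s : ∀ r s → r ≤⁺ r +⁺ s
r≤r+s r s = subst (_≤ val r +ℚ val s) (+-identityʳ (val r)) (+-monoʳ-≤ (val r) (nonneg s))

s≤r+s : ∀ r s → s ≤⁺ r +⁺ s
s≤r+s r s = subst (s ≤⁺_) (+⁺-comm s r) (r≤r+s s r)

+⁺-monoˡ-≤ : ∀ r s e → r ≤⁺ s → r +⁺ e ≤⁺ s +⁺ e
+⁺-monoˡ-≤ r s e = +-monoˡ-≤ (val e)

∸⁺-monoˡ-≤ : ∀ r s e → r ≤⁺ s → r ∸⁺ e ≤⁺ s ∸⁺ e
∸⁺-monoˡ-≤ r s e r≤s = ⊔-monoʳ-≤ 0ℚ (+-monoˡ-≤ (- val e) r≤s)

r≤e⇒r∸e≡0 : ∀ r e → r ≤⁺ e → r ∸⁺ e ≡ 0⁺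
r≤e⇒r∸e≡0 r e r≤e = val-injective (p≥q⇒p⊔q≡p (p≤q⇒p-q≤0 r≤e))

r≤e⇒r∸e≤t : ∀ r e t → r ≤⁺ e → r ∸⁺ e ≤⁺ t
r≤e⇒r∸e≤t r e t r≤e = subst (_≤⁺ t) (sym (r≤e⇒r∸e≡0 r e r≤e)) (nonneg t)

e≤r⇒r∸e≡r-e : ∀ r e → e ≤⁺ r → val (r ∸⁺ e) ≡ val r -ℚ val e
e≤r⇒r∸e≡r-e r e e≤r = p≤q⇒p⊔q≡q (p≤q⇒0≤q-p e≤r)

r-e≤r∸e : ∀ r e → val r -ℚ val e ≤ val (r ∸⁺ e)
r-e≤r∸e r e = p≤q⊔p 0ℚ (val r -ℚ val e)

r-e≤t⇒r∸e≤t : ∀ r e t → val r -ℚ val e ≤ val t → r ∸⁺ e ≤⁺ t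
r-e≤t⇒r∸e≤t r e t = ⊔-lub (nonneg t)

r+e∸e≡r : ∀ r e → (r +⁺ e) ∸⁺ e ≡ r
r+e∸e≡r r e = val-injective (trans (e≤r⇒r∸e≡r-e (r +⁺ e) e (s≤r+s r e)) (p+q-q≡p (val r) (val e)))

r∸e+e≡r : ∀ r e → e ≤⁺ r → (r ∸⁺ e) +⁺ e ≡ r
r∸e+e≡r r e e≤r =
  val-injective (trans (cong (_+ℚ val e) (e≤r⇒r∸e≡r-e r e e≤r)) (p-q+q≡p (val r) (val e)))

r≤r∸e+e : ∀ r e → r ≤⁺ (r ∸⁺ e) +⁺ e
r≤r∸e+e r e = subst (_≤ val ((r ∸⁺ e) +⁺ e)) (p-q+q≡p (val r) (val e))
                    (+-monoˡ-≤ (val e) (r-e≤r∸e r e))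

q<s∸e⇒q+e<s : ∀ q s e → q <⁺ (s ∸⁺ e) → (q +⁺ e) <⁺ s
q<s∸e⇒q+e<s q s e q<s∸e with ≤-total (val e) (val s)
... | inj₁ e≤s = subst (val q +ℚ val e <_) (p-q+q≡p (val s) (val e))
                   (+-monoˡ-< (val e) (subst (val q <_) (e≤r⇒r∸e≡r-e s e e≤s) q<s∸e))
... | inj₂ s≤e = ⊥-elim (<-irrefl refl (<-≤-trans q<s∸e (r≤e⇒r∸e≤t s e q s≤e)))

s∸e<q⇒s<q+e : ∀ q s e → (s ∸⁺ e) <⁺ q → s <⁺ (q +⁺ e)
s∸e<q⇒s<q+e q s e s∸e<q = subst (_< val q +ℚ val e) (p-q+q≡p (val s) (val e))
  (+-monoˡ-< (val e) (≤-<-trans (r-e≤r∸e s e) s∸e<q))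

q<s+e⇒q∸e<s : ∀ q s e → e ≤⁺ q → q <⁺ (s +⁺ e) → (q ∸⁺ e) <⁺ s
q<s+e⇒q∸e<s q s e e≤q q<s+e = subst₂ _<_ (sym (e≤r⇒r∸e≡r-e q e e≤q)) (p+q-q≡p (val s) (val e))
  (+-monoˡ-< (- val e) q<s+e)

s+e<q⇒s<q∸e : ∀ q s e → (s +⁺ e) <⁺ q → s <⁺ (q ∸⁺ e)
s+e<q⇒s<q∸e q s e s+e<q = <-≤-trans
  (subst (_< val q -ℚ val e) (p+q-q≡p (val s) (val e)) (+-monoˡ-< (- val e) s+e<q))
  (r-e≤r∸e q e)

t-e≡[r-e]+[s-e]-ε : ∀ r s t ε e → val t ≡ (val r +ℚ val s) -ℚ val (ε +⁺ e) →
                    val t -ℚ val e ≡ ((val r -ℚ val e) +ℚ (val s -ℚ val e)) -ℚ val ε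
t-e≡[r-e]+[s-e]-ε r s t ε e t≡ = begin
  val t -ℚ val e                                      ≡⟨ cong (_-ℚ val e) t≡ ⟩
  ((val r +ℚ val s) -ℚ (val ε +ℚ val e)) -ℚ val e    ≡⟨ regroup (val r) (val s) (val ε) (val e) ⟩
  ((val r -ℚ val e) +ℚ (val s -ℚ val e)) -ℚ val ε    ∎
  where
  open ≡-Reasoning
  regroup : ∀ r s ε e → ((r +ℚ s) -ℚ (ε +ℚ e)) -ℚ e ≡ ((r -ℚ e) +ℚ (s -ℚ e)) -ℚ ε
  regroup = solve 4 (λ r s ε e → ((r :+ s) :- (ε :+ e)) :- e := ((r :- e) :+ (s :- e)) :- ε) refl

t+e≡[r+e]+[s+e]-[ε+e] : ∀ r s t ε e → val t ≡ (val r +ℚ val s) -ℚ val ε →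
                        val (t +⁺ e) ≡ (val (r +⁺ e) +ℚ val (s +⁺ e)) -ℚ val (ε +⁺ e)
t+e≡[r+e]+[s+e]-[ε+e] r s t ε e t≡ = begin
  val t +ℚ val e                                                 ≡⟨ cong (_+ℚ val e) t≡ ⟩
  ((val r +ℚ val s) -ℚ val ε) +ℚ val e                           ≡⟨ regroup (val r) (val s) (val ε) (val e) ⟩
  ((val r +ℚ val e) +ℚ (val s +ℚ val e)) -ℚ (val ε +ℚ val e)    ∎
  where
  open ≡-Reasoning
  regroup : ∀ r s ε e → ((r +ℚ s) -ℚ ε) +ℚ e ≡ ((r +ℚ e) +ℚ (s +ℚ e)) -ℚ (ε +ℚ e)
  regroup = solve 4 (λ r s ε e → ((r :+ s) :- ε) :+ e := ((r :+ e) :+ (s :+ e)) :- (ε :+ e)) refl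

t∸e≤[r∸e+s∸e]∸ε : ∀ r s t ε e → val t ≡ (val r +ℚ val s) -ℚ val (ε +⁺ e) →
                   t ∸⁺ e ≤⁺ ((r ∸⁺ e) +⁺ (s ∸⁺ e)) ∸⁺ ε
t∸e≤[r∸e+s∸e]∸ε r s t ε e t≡ = r-e≤t⇒r∸e≤t t e (((r ∸⁺ e) +⁺ (s ∸⁺ e)) ∸⁺ ε) (begin
  val t -ℚ val e                                      ≡⟨ t-e≡[r-e]+[s-e]-ε r s t ε e t≡ ⟩
  ((val r -ℚ val e) +ℚ (val s -ℚ val e)) -ℚ val ε    ≤⟨ +-monoˡ-≤ (- val ε) (+-mono-≤ (r-e≤r∸e r e) (r-e≤r∸e s e)) ⟩
  val ((r ∸⁺ e) +⁺ (s ∸⁺ e)) -ℚ val ε                 ≤⟨ r-e≤r∸e ((r ∸⁺ e) +⁺ (s ∸⁺ e)) ε ⟩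
  val (((r ∸⁺ e) +⁺ (s ∸⁺ e)) ∸⁺ ε)                   ∎)
  where open ≤-Reasoning

[r∸e+s∸e]∸ε≤t∸e : ∀ r s t ε e → e ≤⁺ r → e ≤⁺ s → val t ≡ (val r +ℚ val s) -ℚ val (ε +⁺ e) →
                   ((r ∸⁺ e) +⁺ (s ∸⁺ e)) ∸⁺ ε ≤⁺ t ∸⁺ e
[r∸e+s∸e]∸ε≤t∸e r s t ε e e≤r e≤s t≡ = r-e≤t⇒r∸e≤t ((r ∸⁺ e) +⁺ (s ∸⁺ e)) ε (t ∸⁺ e) (begin
  val ((r ∸⁺ e) +⁺ (s ∸⁺ e)) -ℚ val ε                 ≡⟨ cong₂ (λ a b → (a +ℚ b) -ℚ val ε)
                                                              (e≤r⇒r∸e≡r-e r e e≤r) (e≤r⇒r∸e≡r-e s e e≤s) ⟩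
  ((val r -ℚ val e) +ℚ (val s -ℚ val e)) -ℚ val ε    ≡⟨ t-e≡[r-e]+[s-e]-ε r s t ε e t≡ ⟨
  val t -ℚ val e                                      ≤⟨ r-e≤r∸e t e ⟩
  val (t ∸⁺ e)                                        ∎)
  where open ≤-Reasoning

t+e≤[r+e+s+e]∸[ε+e] : ∀ r s t ε e → val t ≡ (val r +ℚ val s) -ℚ val ε →
                      t +⁺ e ≤⁺ ((r +⁺ e) +⁺ (s +⁺ e)) ∸⁺ (ε +⁺ e)
t+e≤[r+e+s+e]∸[ε+e] r s t ε e t≡ = ≤-trans (≤-reflexive (t+e≡[r+e]+[s+e]-[ε+e] r s t ε e t≡))
                                           (r-e≤r∸e ((r +⁺ e) +⁺ (s +⁺ e)) (ε +⁺ e))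

[r+e+s+e]∸[ε+e]≤t+e : ∀ r s t ε e → val t ≡ (val r +ℚ val s) -ℚ val ε →
                      ((r +⁺ e) +⁺ (s +⁺ e)) ∸⁺ (ε +⁺ e) ≤⁺ t +⁺ e
[r+e+s+e]∸[ε+e]≤t+e r s t ε e t≡ = r-e≤t⇒r∸e≤t ((r +⁺ e) +⁺ (s +⁺ e)) (ε +⁺ e) (t +⁺ e)
                                     (≤-reflexive (sym (t+e≡[r+e]+[s+e]-[ε+e] r s t ε e t≡)))

L-antitone : ∀ {ε φ r s} → r ≤⁺ s → ε ⊢ L s φ ⇒ L r φ
L-antitone {ε} {φ} {r} {s} r≤s =
  subst (λ u → ε ⊢ L u φ ⇒ L r φ) (trans (+⁺-comm r (s ∸⁺ r)) (r∸e+e≡r s r r≤s)) (A2 r (s ∸⁺ r))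

L-≤ε : ∀ {ε φ r} → r ≤⁺ ε → ε ⊢ L r φ
L-≤ε r≤ε = mp (L-antitone r≤ε) A1

-- A3 and A4 for every admissible index: when r + s < ε there is no instance of
-- the axiom, but then L t φ, resp. L r (φ ∧ᶠ ψ), has index at most ε.
A3-≤ : ∀ {ε φ ψ} r s t → t ≤⁺ (r +⁺ s) ∸⁺ ε →
       ε ⊢ L r (φ ∧ᶠ ψ) ∧ᶠ L s (φ ∧ᶠ ¬ᶠ ψ) ⇒ L t φ
A3-≤ {ε} r s t t≤ with ≤-total (val ε) (val (r +⁺ s))
... | inj₁ ε≤r+s = ⇒-trans (A3 r s ((r +⁺ s) ∸⁺ ε) (e≤r⇒r∸e≡r-e (r +⁺ s) ε ε≤r+s)) (L-antitone t≤)
... | inj₂ r+s≤ε = ⇒-const (L-≤ε (≤-trans t≤ (r≤e⇒r∸e≤t (r +⁺ s) ε ε r+s≤ε)))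

A4-≥ : ∀ {ε φ ψ} r s t → (r +⁺ s) ∸⁺ ε ≤⁺ t →
       ε ⊢ ¬ᶠ L r (φ ∧ᶠ ψ) ∧ᶠ ¬ᶠ L s (φ ∧ᶠ ¬ᶠ ψ) ⇒ ¬ᶠ L t φ
A4-≥ {ε} r s t ≤t with ≤-total (val ε) (val (r +⁺ s))
... | inj₁ ε≤r+s = ⇒-trans (A4 r s ((r +⁺ s) ∸⁺ ε) (e≤r⇒r∸e≡r-e (r +⁺ s) ε ε≤r+s)) (⇒-contrapose (L-antitone ≤t))
... | inj₂ r+s≤ε = refuteˡ (L-≤ε (≤-trans (r≤r+s r s) r+s≤ε))

eval-⟨⟩₋ : ∀ e v φ → eval v (⟨ φ ⟩₋ e) ≡ eval (λ r ψ → v (r ∸⁺ e) (⟨ ψ ⟩₋ e)) φ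
eval-⟨⟩₋ e v ⊤ᶠ = refl
eval-⟨⟩₋ e v (¬ᶠ φ) = cong not (eval-⟨⟩₋ e v φ)
eval-⟨⟩₋ e v (φ ∧ᶠ ψ) = cong₂ _∧_ (eval-⟨⟩₋ e v φ) (eval-⟨⟩₋ e v ψ)
eval-⟨⟩₋ e v (L r φ) = refl

eval-⟨⟩⁺ : ∀ e v φ → eval v (⟨ φ ⟩⁺ e) ≡ eval (λ r ψ → v (r +⁺ e) (⟨ ψ ⟩⁺ e)) φ
eval-⟨⟩⁺ e v ⊤ᶠ = refl
eval-⟨⟩⁺ e v (¬ᶠ φ) = cong not (eval-⟨⟩⁺ e v φ)
eval-⟨⟩⁺ e v (φ ∧ᶠ ψ) = cong₂ _∧_ (eval-⟨⟩⁺ e v φ) (eval-⟨⟩⁺ e v ψ)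
eval-⟨⟩⁺ e v (L r φ) = refl

⊢⟨⟩₋ : ∀ {ε} e {φ} → ε +⁺ e ⊢ φ → ε ⊢ ⟨ φ ⟩₋ e
⊢⟨⟩₋ e {φ} (taut ⊨φ) = taut λ v → trans (eval-⟨⟩₋ e v φ) (⊨φ _)
⊢⟨⟩₋ e (mp ⊢φ⇒ψ ⊢φ) = mp (⊢⟨⟩₋ e ⊢φ⇒ψ) (⊢⟨⟩₋ e ⊢φ)
⊢⟨⟩₋ {ε} e A1 = L-≤ε (≤-reflexive (cong val (r+e∸e≡r ε e)))
⊢⟨⟩₋ e (A2 r s) = L-antitone (∸⁺-monoˡ-≤ r (r +⁺ s) e (r≤r+s r s))
⊢⟨⟩₋ {ε} e (A3 r s t t≡) = A3-≤ (r ∸⁺ e) (s ∸⁺ e) (t ∸⁺ e) (t∸e≤[r∸e+s∸e]∸ε r s t ε e t≡)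
⊢⟨⟩₋ {ε} e (A4 r s t t≡) with ≤-total (val e) (val r) | ≤-total (val e) (val s)
... | inj₂ r≤e | _ = refuteˡ (L-≤ε (r≤e⇒r∸e≤t r e ε r≤e))
... | inj₁ _ | inj₂ s≤e = refuteʳ (L-≤ε (r≤e⇒r∸e≤t s e ε s≤e))
... | inj₁ e≤r | inj₁ e≤s = A4-≥ (r ∸⁺ e) (s ∸⁺ e) (t ∸⁺ e) ([r∸e+s∸e]∸ε≤t∸e r s t ε e e≤r e≤s t≡)
⊢⟨⟩₋ e (R1 r ⊢φ⇒ψ) = R1 (r ∸⁺ e) (⊢⟨⟩₋ e ⊢φ⇒ψ)
⊢⟨⟩₋ {ε} e (R2 s ⊢L<s) = R2 (s ∸⁺ e) λ q q<s∸e →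
  subst (λ u → ε ⊢ L u _) (r+e∸e≡r q e) (⊢⟨⟩₋ e (⊢L<s (q +⁺ e) (q<s∸e⇒q+e<s q s e q<s∸e)))
⊢⟨⟩₋ {ε} e (R3 s ⊢L>s) = R3 (s ∸⁺ e) λ q s∸e<q →
  subst (λ u → ε ⊢ L u _) (r+e∸e≡r q e) (⊢⟨⟩₋ e (⊢L>s (q +⁺ e) (s∸e<q⇒s<q+e q s e s∸e<q)))

⊢⟨⟩⁺ : ∀ {ε} e {φ} → ε ⊢ φ → ε +⁺ e ⊢ ⟨ φ ⟩⁺ e
⊢⟨⟩⁺ e {φ} (taut ⊨φ) = taut λ v → trans (eval-⟨⟩⁺ e v φ) (⊨φ _)
⊢⟨⟩⁺ e (mp ⊢φ⇒ψ ⊢φ) = mp (⊢⟨⟩⁺ e ⊢φ⇒ψ) (⊢⟨⟩⁺ e ⊢φ)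
⊢⟨⟩⁺ e A1 = A1
⊢⟨⟩⁺ e (A2 r s) = L-antitone (+⁺-monoˡ-≤ r (r +⁺ s) e (r≤r+s r s))
⊢⟨⟩⁺ {ε} e (A3 r s t t≡) = A3-≤ (r +⁺ e) (s +⁺ e) (t +⁺ e) (t+e≤[r+e+s+e]∸[ε+e] r s t ε e t≡)
⊢⟨⟩⁺ {ε} e (A4 r s t t≡) = A4-≥ (r +⁺ e) (s +⁺ e) (t +⁺ e) ([r+e+s+e]∸[ε+e]≤t+e r s t ε e t≡)
⊢⟨⟩⁺ e (R1 r ⊢φ⇒ψ) = R1 (r +⁺ e) (⊢⟨⟩⁺ e ⊢φ⇒ψ)
⊢⟨⟩⁺ {ε} e {L _ φ} (R2 s ⊢L<s) = R2 (s +⁺ e) ⊢L<s+e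
  where
  ⊢L<s+e : ∀ q → q <⁺ (s +⁺ e) → ε +⁺ e ⊢ L q (⟨ φ ⟩⁺ e)
  ⊢L<s+e q q<s+e with ≤-total (val e) (val q)
  ... | inj₁ e≤q = subst (λ u → ε +⁺ e ⊢ L u _) (r∸e+e≡r q e e≤q)
                     (⊢⟨⟩⁺ e (⊢L<s (q ∸⁺ e) (q<s+e⇒q∸e<s q s e e≤q q<s+e)))
  ... | inj₂ q≤e = L-≤ε (≤-trans q≤e (s≤r+s ε e))
⊢⟨⟩⁺ {ε} e (R3 s ⊢L>s) = R3 (s +⁺ e) λ q s+e<q →
  subst (λ u → ε +⁺ e ⊢ L u _) (r∸e+e≡r q e (≤-trans (s≤r+s s e) (<⇒≤ s+e<q)))
    (⊢⟨⟩⁺ e (⊢L>s (q ∸⁺ e) (s+e<q⇒s<q∸e q s e s+e<q)))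

⟨⟨⟩⁺⟩₋≡ : ∀ e φ → ⟨ ⟨ φ ⟩⁺ e ⟩₋ e ≡ φ
⟨⟨⟩⁺⟩₋≡ e ⊤ᶠ = refl
⟨⟨⟩⁺⟩₋≡ e (¬ᶠ φ) = cong ¬ᶠ_ (⟨⟨⟩⁺⟩₋≡ e φ)
⟨⟨⟩⁺⟩₋≡ e (φ ∧ᶠ ψ) = cong₂ _∧ᶠ_ (⟨⟨⟩⁺⟩₋≡ e φ) (⟨⟨⟩⁺⟩₋≡ e ψ)
⟨⟨⟩⁺⟩₋≡ e (L r φ) = cong₂ L (r+e∸e≡r r e) (⟨⟨⟩⁺⟩₋≡ e φ)

infix 2 _⊢_↔_
_⊢_↔_ : ℚ⁺ → Form → Form → Set
ε ⊢ φ ↔ ψ = (ε ⊢ φ ⇒ ψ) × (ε ⊢ ψ ⇒ φ)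

⟨⟨⟩₋⟩⁺↔ : ∀ {δ} e φ → e ≤⁺ δ → δ ⊢ ⟨ ⟨ φ ⟩₋ e ⟩⁺ e ↔ φ
⟨⟨⟩₋⟩⁺↔ e ⊤ᶠ e≤δ = ⇒-refl , ⇒-refl
⟨⟨⟩₋⟩⁺↔ e (¬ᶠ φ) e≤δ with ⟨⟨⟩₋⟩⁺↔ e φ e≤δ
... | to , from = ⇒-contrapose from , ⇒-contrapose to
⟨⟨⟩₋⟩⁺↔ e (φ ∧ᶠ ψ) e≤δ with ⟨⟨⟩₋⟩⁺↔ e φ e≤δ | ⟨⟨⟩₋⟩⁺↔ e ψ e≤δ
... | toφ , fromφ | toψ , fromψ = ∧-mono toφ toψ , ∧-mono fromφ fromψ
⟨⟨⟩₋⟩⁺↔ {δ} e (L r φ) e≤δ with ⟨⟨⟩₋⟩⁺↔ e φ e≤δ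
... | to , from = ⇒-trans (R1 _ to) (L-antitone (r≤r∸e+e r e)) , ⇒-trans (R1 r from) raise
  where
  raise : δ ⊢ L r (⟨ ⟨ φ ⟩₋ e ⟩⁺ e) ⇒ L ((r ∸⁺ e) +⁺ e) (⟨ ⟨ φ ⟩₋ e ⟩⁺ e)
  raise with ≤-total (val e) (val r)
  ... | inj₁ e≤r = L-antitone (≤-reflexive (cong val (r∸e+e≡r r e e≤r)))
  ... | inj₂ r≤e = ⇒-const (L-≤ε (subst (_≤⁺ δ) (sym r∸e+e≡e) e≤δ))
    where
    r∸e+e≡e : (r ∸⁺ e) +⁺ e ≡ e
    r∸e+e≡e = trans (cong (_+⁺ e) (r≤e⇒r∸e≡0 r e r≤e)) (+⁺-identityˡ e)

⊢⟨⟩₋⁻¹ : ∀ {ε} e {φ} → ε ⊢ ⟨ φ ⟩₋ e → ε +⁺ e ⊢ φ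
⊢⟨⟩₋⁻¹ {ε} e {φ} ⊢⟨φ⟩₋ = mp (proj₁ (⟨⟨⟩₋⟩⁺↔ e φ (s≤r+s ε e))) (⊢⟨⟩⁺ e ⊢⟨φ⟩₋)

⊢⟨⟩⁺⁻¹ : ∀ {ε} e {φ} → ε +⁺ e ⊢ ⟨ φ ⟩⁺ e → ε ⊢ φ
⊢⟨⟩⁺⁻¹ {ε} e {φ} ⊢⟨φ⟩⁺ = subst (ε ⊢_) (⟨⟨⟩⁺⟩₋≡ e φ) (⊢⟨⟩₋ e ⊢⟨φ⟩⁺)

Pos⇒⊢⟨⟩⁺⇒ : ∀ {δ} e {φ} → Pos φ → δ ⊢ ⟨ φ ⟩⁺ e ⇒ φ
Pos⇒⊢⟨⟩⁺⇒ e pos⊤ = ⇒-refl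
Pos⇒⊢⟨⟩⁺⇒ e (pos∧ pφ pψ) = ∧-mono (Pos⇒⊢⟨⟩⁺⇒ e pφ) (Pos⇒⊢⟨⟩⁺⇒ e pψ)
Pos⇒⊢⟨⟩⁺⇒ e (pos∨ pφ pψ) = ∨-mono (Pos⇒⊢⟨⟩⁺⇒ e pφ) (Pos⇒⊢⟨⟩⁺⇒ e pψ)
Pos⇒⊢⟨⟩⁺⇒ e (posL {r} pφ) = ⇒-trans (L-antitone (r≤r+s r e)) (R1 r (Pos⇒⊢⟨⟩⁺⇒ e pφ))

Pos⇒⊢-mono : ∀ e {ε φ} → Pos φ → ε ⊢ φ → e +⁺ ε ⊢ φ
Pos⇒⊢-mono e {ε} {φ} pφ ⊢φ = subst (_⊢ φ) (+⁺-comm ε e) (mp (Pos⇒⊢⟨⟩⁺⇒ e pφ) (⊢⟨⟩⁺ e ⊢φ))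

lemma4 : ∀ (φ : Form) (ε ε′ : ℚ⁺) →
           ((ε +⁺ ε′ ⊢ φ) ⇔ (ε ⊢ ⟨ φ ⟩₋ ε′))
         × ((ε ⊢ φ) ⇔ (⊢₀ ⟨ φ ⟩₋ ε))
         × ((ε ⊢ φ) ⇔ (ε +⁺ ε′ ⊢ ⟨ φ ⟩⁺ ε′))
         × ((⊢₀ φ) ⇔ (ε ⊢ ⟨ φ ⟩⁺ ε))
         × (Pos φ → ε′ ⊢ φ → ε +⁺ ε′ ⊢ φ)
lemma4 φ ε ε′ =
  mk⇔ (⊢⟨⟩₋ ε′) (⊢⟨⟩₋⁻¹ ε′) ,
  mk⇔ (λ ⊢φ → ⊢⟨⟩₋ ε (from0+ε ⊢φ)) (λ ⊢⟨φ⟩₋ → to0+ε (⊢⟨⟩₋⁻¹ ε ⊢⟨φ⟩₋)) ,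
  mk⇔ (⊢⟨⟩⁺ ε′) (⊢⟨⟩⁺⁻¹ ε′) ,
  mk⇔ (λ ⊢φ → to0+ε (⊢⟨⟩⁺ ε ⊢φ)) (λ ⊢⟨φ⟩⁺ → ⊢⟨⟩⁺⁻¹ ε (from0+ε ⊢⟨φ⟩⁺)) ,
  Pos⇒⊢-mono ε
  where
  to0+ε : ∀ {ψ} → 0⁺ +⁺ ε ⊢ ψ → ε ⊢ ψ
  to0+ε {ψ} = subst (_⊢ ψ) (+⁺-identityˡ ε)
  from0+ε : ∀ {ψ} → ε ⊢ ψ → 0⁺ +⁺ ε ⊢ ψ
  from0+ε {ψ} = subst (_⊢ ψ) (sym (+⁺-identityˡ ε))
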